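{- Let $G$ be a bipartite graph with bipartition classes $X$ and $Y$, and list the vertices of $X$ as $x_1,\dots,x_{|X|}$ so that $d(x_1)\ge d(x_2)\ge\cdots\ge d(x_{|X|})$. Let $\delta(X)$ be the minimum degree of a vertex in $X$ and $\Delta(Y)$ the maximum degree of a vertex in $Y$, and assume $\delta(X)\ge\Delta(Y)$. Then for any number $t$, $$P\beta_t(G)=\min\left\{k:\ \sum_{i=1}^{k} d(x_i)\ge t\right\}.$$
   Context: For a graph $G$ and a number $t$, a $t$-partial vertex cover is a set $S\subseteq V(G)$ such that at least $t$ edges of $G$ have an endpoint in $S$; $P\beta_t(G)$ denotes the minimum size of a $t$-partial vertex cover of $G$. $d(x)$ denotes the degree of $x$. -}

module Defs where

open import Data.Nat using (ℕ; _≤_; _<ᵇ_)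
open import Data.Bool using (Bool; true; false; if_then_else_; _∧_; _∨_)
open import Data.Fin using (Fin; toℕ)
import Data.Fin as F
open import Data.Fin.Subset using (Subset; ∣_∣)
open import Data.Vec using (lookup; tabulate; sum)
open import Data.Product using (Σ; _×_; ∃)
open import Relation.Binary.PropositionalEquality using (_≡_; _≢_)
open import Function.Definitions using (Injective)

count : ∀ {n} → (Fin n → Bool) → ℕ
count f = sum (tabulate (λ i → if f i then 1 else 0))

record Graph (n : ℕ) : Set where
  field
    adj    : Fin n → Fin n → Bool
    sym    : ∀ i j → adj i j ≡ adj j i
    irrefl : ∀ i → adj i i ≡ false
open Graph public

degree : ∀ {n} → Graph n → Fin n → ℕ
degree G v = count (adj G v)

-- number of edges {i,j} (counted once, via i < j) having an endpoint in S
coveredEdges : ∀ {n} → Graph n → Subset n → ℕ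
coveredEdges G S =
  sum (tabulate (λ i → count (λ j →
    adj G i j ∧ (toℕ i <ᵇ toℕ j) ∧ (lookup S i ∨ lookup S j))))

IsPartialVertexCover : ∀ {n} → Graph n → ℕ → Subset n → Set
IsPartialVertexCover G t S = t ≤ coveredEdges G S

IsMin : (ℕ → Set) → ℕ → Set
IsMin P m = P m × (∀ k → P k → m ≤ k)

IsPβ : ∀ {n} → Graph n → ℕ → ℕ → Set
IsPβ {n} G t m =
  IsMin (λ k → Σ (Subset n) (λ S → ∣ S ∣ ≡ k × IsPartialVertexCover G t S)) m

-- side v ≡ true means v ∈ X, false means v ∈ Y; every edge joins X and Y
IsBipartition : ∀ {n} → Graph n → (Fin n → Bool) → Set
IsBipartition G side = ∀ i j → adj G i j ≡ true → side i ≢ side j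

Enumerates : ∀ {n p} → (Fin n → Bool) → (Fin p → Fin n) → Set
Enumerates side x =
  Injective _≡_ _≡_ x
  × (∀ i → side (x i) ≡ true)
  × (∀ v → side v ≡ true → ∃ (λ i → x i ≡ v))

DegreeNonincreasing : ∀ {n p} → Graph n → (Fin p → Fin n) → Set
DegreeNonincreasing G x = ∀ i j → i F.≤ j → degree G (x j) ≤ degree G (x i)

MinDegXGeMaxDegY : ∀ {n} → Graph n → (Fin n → Bool) → Set
MinDegXGeMaxDegY G side =
  ∀ u v → side u ≡ true → side v ≡ false → degree G v ≤ degree G u

-- Σ_{i=1}^{k} d(x_i)  (x indexed from 0 here)
prefixDegSum : ∀ {n p} → Graph n → (Fin p → Fin n) → ℕ → ℕ
prefixDegSum G x k =
  sum (tabulate (λ i → if toℕ i <ᵇ k then degree G (x i) else 0))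

module Submission where

-- A set S of at most p vertices covers at most Σ_{v∈S} d(v) edges. Since δ(X) ≥ Δ(Y) and the
-- xᵢ are listed by decreasing degree, x₁, …, x_|S| carry the |S| largest degrees of G, so S covers
-- at most Σ_{i≤|S|} d(xᵢ) edges; a larger S covers at most |E| = Σ_{i≤p} d(xᵢ). Conversely
-- {x₁, …, x_k} ⊆ X is independent, so it covers exactly Σ_{i≤k} d(xᵢ) edges. Hence every
-- feasible size of either minimisation problem bounds a feasible size of the other from above.

open import Data.Bool using (Bool; true; false; if_then_else_; _∧_; _∨_)
open import Data.Bool.Properties using (∨-zeroʳ; T-≡)
open import Data.Empty using (⊥-elim)
open import Data.Fin using (Fin; zero; suc; toℕ; fromℕ<; _≟_)
open import Data.Fin.Properties using (suc-injective; toℕ-injective; toℕ<n; toℕ-fromℕ<)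
open import Data.Fin.Subset using (Subset; ∣_∣)
open import Data.Nat using (ℕ; zero; suc; _+_; _*_; _≤_; _<_; _<ᵇ_; z≤n; s≤s; s≤s⁻¹; _≤?_; _<?_)
open import Data.Nat.Properties hiding (_≟_; suc-injective)
open import Data.Product using (Σ; ∃; _×_; _,_; proj₁; proj₂; map)
open import Data.Vec using (_∷_; []; lookup; tabulate)
import Data.Vec as Vec
open import Data.Vec.Properties using (lookup∘tabulate)
open import Function using (_∘_; const; id)
open import Function.Bundles using (_⇔_; mk⇔; Equivalence)
open import Function.Definitions using (Injective)
open import Relation.Binary.PropositionalEquality
open import Relation.Nullary using (yes; no; does)
open import Relation.Nullary.Decidable using (dec-true)
open import Relation.Nullary.Reflects using (ofʸ; ofⁿ)
open import Algebra.Properties.Semiring.Sum +-*-semiring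
  using (sum; sum-cong-≗; sum-replicate-zero; ∑-distrib-+; ∑-comm; *-distribˡ-sum)

open import Defs hiding (sym)

⟦_⟧ : Bool → ℕ
⟦ b ⟧ = if b then 1 else 0

sumOver : ∀ {n} → (Fin n → Bool) → (Fin n → ℕ) → ℕ
sumOver A w = sum (λ v → if A v then w v else 0)

size : ∀ {n} → (Fin n → Bool) → ℕ
size A = sumOver A (const 1)

sum-tabulate : ∀ {n} (f : Fin n → ℕ) → Vec.sum (tabulate f) ≡ sum f
sum-tabulate {zero}  f = refl
sum-tabulate {suc n} f = cong (f zero +_) (sum-tabulate (f ∘ suc))

sum-mono : ∀ {n} {f g : Fin n → ℕ} → (∀ i → f i ≤ g i) → sum f ≤ sum g
sum-mono {zero}  f≤g = z≤n
sum-mono {suc n} f≤g = +-mono-≤ (f≤g zero) (sum-mono (f≤g ∘ suc))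

⟦⟧-* : ∀ b m → ⟦ b ⟧ * m ≡ (if b then m else 0)
⟦⟧-* true  m = +-identityʳ m
⟦⟧-* false m = refl

sumOver≡sum-* : ∀ {n} (A : Fin n → Bool) (w : Fin n → ℕ) → sumOver A w ≡ sum (λ v → ⟦ A v ⟧ * w v)
sumOver≡sum-* A w = sum-cong-≗ (λ v → sym (⟦⟧-* (A v) (w v)))

sumOver-cong : ∀ {n} {A B : Fin n → Bool} (w : Fin n → ℕ) → (∀ v → A v ≡ B v) → sumOver A w ≡ sumOver B w
sumOver-cong w A≗B = sum-cong-≗ (λ v → cong (λ b → if b then w v else 0) (A≗B v))

*-size : ∀ {n} (c : ℕ) (A : Fin n → Bool) → c * size A ≡ sumOver A (const c)
*-size c A = trans (*-distribˡ-sum c (⟦_⟧ ∘ A)) (sum-cong-≗ (λ v → c*⟦⟧ (A v)))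
  where
  c*⟦⟧ : ∀ b → c * ⟦ b ⟧ ≡ (if b then c else 0)
  c*⟦⟧ true  = *-identityʳ c
  c*⟦⟧ false = *-zeroʳ c

size≤ : ∀ {n} (A : Fin n → Bool) → size A ≤ n
size≤ {zero}  A = z≤n
size≤ {suc n} A with A zero
... | true  = s≤s (size≤ (A ∘ suc))
... | false = m≤n⇒m≤1+n (size≤ (A ∘ suc))

∣∣≡size : ∀ {n} (S : Subset n) → ∣ S ∣ ≡ size (lookup S)
∣∣≡size []          = refl
∣∣≡size (true  ∷ S) = cong suc (∣∣≡size S)
∣∣≡size (false ∷ S) = ∣∣≡size S

sumOver-∨ : ∀ {n} {A B : Fin n → Bool} (w : Fin n → ℕ) → (∀ v → A v ≡ true → B v ≡ false) →
            sumOver (λ v → A v ∨ B v) w ≡ sumOver A w + sumOver B w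
sumOver-∨ {A = A} {B} w disjoint =
  trans (sum-cong-≗ split) (∑-distrib-+ (λ v → if A v then w v else 0) (λ v → if B v then w v else 0))
  where
  split : ∀ v → (if A v ∨ B v then w v else 0) ≡ (if A v then w v else 0) + (if B v then w v else 0)
  split v with A v in Av | B v in Bv
  ... | true  | true  with trans (sym Bv) (disjoint v Av)
  ...                    | ()
  split v | true  | false = sym (+-identityʳ (w v))
  split v | false | _     = refl

sumOver-point : ∀ {n} (u : Fin n) (w : Fin n → ℕ) → sumOver (λ v → does (u ≟ v)) w ≡ w u
sumOver-point {suc n} zero    w = trans (cong (w zero +_) (sum-replicate-zero n)) (+-identityʳ (w zero))
sumOver-point {suc n} (suc u) w = sumOver-point u (w ∘ suc)

-- Vertices of A outside B weigh at most c and those of B outside A at least c, so once c·|B| is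
-- added on the left and c·|A| on the right the comparison holds vertex by vertex.
sumOver-threshold : ∀ {n} (w : Fin n → ℕ) (A B : Fin n → Bool) (c : ℕ) →
                    (∀ v → B v ≡ true → c ≤ w v) → (∀ v → B v ≡ false → w v ≤ c) →
                    size A ≤ size B → sumOver A w ≤ sumOver B w
sumOver-threshold w A B c above below |A|≤|B| = +-cancelʳ-≤ (c * size B) _ _ (begin
    sumOver A w + c * size B
  ≡⟨ cong (sumOver A w +_) (*-size c B) ⟩
    sumOver A w + sumOver B (const c)
  ≡⟨ ∑-distrib-+ (λ v → if A v then w v else 0) (λ v → if B v then c else 0) ⟨
    sum (λ v → (if A v then w v else 0) + (if B v then c else 0))
  ≤⟨ sum-mono exchange ⟩
    sum (λ v → (if B v then w v else 0) + (if A v then c else 0))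
  ≡⟨ ∑-distrib-+ (λ v → if B v then w v else 0) (λ v → if A v then c else 0) ⟩
    sumOver B w + sumOver A (const c)
  ≡⟨ cong (sumOver B w +_) (*-size c A) ⟨
    sumOver B w + c * size A
  ≤⟨ +-monoʳ-≤ (sumOver B w) (*-monoʳ-≤ c |A|≤|B|) ⟩
    sumOver B w + c * size B ∎)
  where
  open ≤-Reasoning
  exchange : ∀ v → (if A v then w v else 0) + (if B v then c else 0)
                 ≤ (if B v then w v else 0) + (if A v then c else 0)
  exchange v with A v | B v in Bv
  ... | true  | true  = ≤-refl
  ... | false | false = ≤-refl
  ... | true  | false = ≤-trans (≤-reflexive (+-identityʳ (w v))) (below v Bv)
  ... | false | true  = ≤-trans (above v Bv) (≤-reflexive (sym (+-identityʳ (w v))))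

prefix : ∀ {p} → ℕ → Fin p → Bool
prefix k i = toℕ i <ᵇ k

prefix-sound : ∀ {p} {k} (i : Fin p) → prefix k i ≡ true → toℕ i < k
prefix-sound {k = k} i i<ᵇk = <ᵇ⇒< (toℕ i) k (Equivalence.from T-≡ i<ᵇk)

prefix-complete : ∀ {p} {k} (i : Fin p) → toℕ i < k → prefix k i ≡ true
prefix-complete i i<k = Equivalence.to T-≡ (<⇒<ᵇ i<k)

size-prefix : ∀ {p} k → k ≤ p → size {p} (prefix k) ≡ k
size-prefix {zero}  zero    z≤n       = refl
size-prefix {suc p} zero    _         = sum-replicate-zero p
size-prefix {suc p} (suc k) (s≤s k≤p) = cong suc (size-prefix k k≤p)

image : ∀ {p n} → (Fin p → Fin n) → (Fin p → Bool) → Fin n → Bool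
image {zero}  x P v = false
image {suc p} x P v = (P zero ∧ does (x zero ≟ v)) ∨ image (x ∘ suc) (P ∘ suc) v

image-sound : ∀ {p n} (x : Fin p → Fin n) (P : Fin p → Bool) v →
              image x P v ≡ true → ∃ λ i → P i ≡ true × x i ≡ v
image-sound {suc p} x P v v∈ with P zero in P₀ | x zero ≟ v
... | true  | yes x₀≡v = zero , P₀ , x₀≡v
... | true  | no  _    = map suc id (image-sound (x ∘ suc) (P ∘ suc) v v∈)
... | false | _        = map suc id (image-sound (x ∘ suc) (P ∘ suc) v v∈)

image-complete : ∀ {p n} (x : Fin p → Fin n) (P : Fin p → Bool) i → P i ≡ true → image x P (x i) ≡ true
image-complete x P zero    Pi rewrite Pi | dec-true (x zero ≟ x zero) refl = refl
image-complete x P (suc i) Pi =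
  trans (cong (P zero ∧ does (x zero ≟ x (suc i)) ∨_) (image-complete (x ∘ suc) (P ∘ suc) i Pi)) (∨-zeroʳ _)

sumOver-image : ∀ {p n} (x : Fin p → Fin n) → Injective _≡_ _≡_ x →
                ∀ (P : Fin p → Bool) (w : Fin n → ℕ) → sumOver (image x P) w ≡ sumOver P (w ∘ x)
sumOver-image {zero}  {n} x x-inj P w = sum-replicate-zero n
sumOver-image {suc p} {n} x x-inj P w = begin
    sumOver (image x P) w
  ≡⟨ sumOver-∨ w disjoint ⟩
    sumOver (λ v → P zero ∧ does (x zero ≟ v)) w + sumOver (image (x ∘ suc) (P ∘ suc)) w
  ≡⟨ cong₂ _+_ (head-term (P zero)) (sumOver-image (x ∘ suc) (suc-injective ∘ x-inj) (P ∘ suc) w) ⟩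
    sumOver P (w ∘ x) ∎
  where
  open ≡-Reasoning
  head-term : ∀ b → sumOver (λ v → b ∧ does (x zero ≟ v)) w ≡ (if b then w (x zero) else 0)
  head-term true  = sumOver-point (x zero) w
  head-term false = sum-replicate-zero n
  disjoint : ∀ v → (P zero ∧ does (x zero ≟ v)) ≡ true → image (x ∘ suc) (P ∘ suc) v ≡ false
  disjoint v hit with P zero | x zero ≟ v | image (x ∘ suc) (P ∘ suc) v in v∈
  disjoint v hit | true | yes refl | true with image-sound (x ∘ suc) (P ∘ suc) (x zero) v∈
  ... | _ , _ , x[1+i]≡x₀ with x-inj x[1+i]≡x₀
  ...   | ()
  disjoint v hit | _ | _ | false = refl

Independent : ∀ {n} → Graph n → (Fin n → Bool) → Set
Independent G A = ∀ i j → adj G i j ≡ true → A i ≡ true → A j ≡ false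

Independent-⊆ : ∀ {n} (G : Graph n) {A B : Fin n → Bool} → (∀ v → A v ≡ true → B v ≡ true) →
                Independent G B → Independent G A
Independent-⊆ G {A} A⊆B indepB i j eᵢⱼ Ai with A j in Aj
... | false = refl
... | true with trans (sym (A⊆B j Aj)) (indepB i j eᵢⱼ (A⊆B i Ai))
...   | ()

bipartition-independent : ∀ {n} (G : Graph n) {side : Fin n → Bool} →
                          IsBipartition G side → Independent G side
bipartition-independent G {side} bip i j eᵢⱼ sideᵢ with side j in sideⱼ
... | false = refl
... | true  = ⊥-elim (bip i j eᵢⱼ (trans sideᵢ (sym sideⱼ)))

⟦∧∨⟧≤ : ∀ a l s r₁ r₂ → (a ≡ true → s ≡ true → (r₁ ∨ r₂) ≡ true) →
        ⟦ a ∧ l ∧ s ⟧ ≤ ⟦ a ∧ l ⟧ * (⟦ r₁ ⟧ + ⟦ r₂ ⟧)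
⟦∧∨⟧≤ false _     _     _     _     _    = z≤n
⟦∧∨⟧≤ true  false _     _     _     _    = z≤n
⟦∧∨⟧≤ true  true  false _     _     _    = z≤n
⟦∧∨⟧≤ true  true  true  true  _     _    = s≤s z≤n
⟦∧∨⟧≤ true  true  true  false true  _    = s≤s z≤n
⟦∧∨⟧≤ true  true  true  false false hit with hit refl refl
... | ()

⟦∧∨⟧-exclusive : ∀ a l s₁ s₂ → (a ≡ true → s₁ ≡ true → s₂ ≡ false) →
                 ⟦ a ∧ l ⟧ * (⟦ s₁ ⟧ + ⟦ s₂ ⟧) ≡ ⟦ a ∧ l ∧ (s₁ ∨ s₂) ⟧
⟦∧∨⟧-exclusive false _     _     _     _    = refl
⟦∧∨⟧-exclusive true  false _     _     _    = refl
⟦∧∨⟧-exclusive true  true  true  true  excl with excl refl refl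
... | ()
⟦∧∨⟧-exclusive true  true  true  false _    = refl
⟦∧∨⟧-exclusive true  true  false s₂    _    = +-identityʳ ⟦ s₂ ⟧

module _ {n} (G : Graph n) where

  forward : Fin n → Fin n → Bool
  forward i j = adj G i j ∧ (toℕ i <ᵇ toℕ j)

  forward+backward : ∀ i j → ⟦ forward i j ⟧ + ⟦ forward j i ⟧ ≡ ⟦ adj G i j ⟧
  forward+backward i j rewrite Graph.sym G j i
    with adj G i j in eᵢⱼ | toℕ i <ᵇ toℕ j | <ᵇ-reflects-< (toℕ i) (toℕ j)
                          | toℕ j <ᵇ toℕ i | <ᵇ-reflects-< (toℕ j) (toℕ i)
  ... | false | _     | _       | _     | _       = refl
  ... | true  | true  | _       | false | _       = refl
  ... | true  | false | _       | true  | _       = refl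
  ... | true  | true  | ofʸ i<j | true  | ofʸ j<i = ⊥-elim (<-asym i<j j<i)
  ... | true  | false | ofⁿ i≮j | false | ofⁿ j≮i
    with toℕ-injective (≤-antisym (≮⇒≥ j≮i) (≮⇒≥ i≮j))
  ...   | refl with trans (sym eᵢⱼ) (Graph.irrefl G i)
  ...          | ()

  handshake : ∀ (h : Fin n → ℕ) →
              sum (λ i → sum (λ j → ⟦ forward i j ⟧ * (h i + h j))) ≡ sum (λ v → h v * degree G v)
  handshake h = begin
      sum (λ i → sum (λ j → ⟦ forward i j ⟧ * (h i + h j)))
    ≡⟨ sum-cong-≗ (λ i → trans (sum-cong-≗ (λ j → *-distribˡ-+ ⟦ forward i j ⟧ (h i) (h j)))
                               (∑-distrib-+ (out i) (λ j → in′ j i))) ⟩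
      sum (λ i → sum (out i) + sum (λ j → in′ j i))
    ≡⟨ ∑-distrib-+ (λ i → sum (out i)) (λ i → sum (λ j → in′ j i)) ⟩
      sum (λ i → sum (out i)) + sum (λ i → sum (λ j → in′ j i))
    ≡⟨ cong (sum (λ i → sum (out i)) +_) (∑-comm (λ i j → in′ j i)) ⟩
      sum (λ i → sum (out i)) + sum (λ j → sum (in′ j))
    ≡⟨ ∑-distrib-+ (λ i → sum (out i)) (λ i → sum (in′ i)) ⟨
      sum (λ i → sum (out i) + sum (in′ i))
    ≡⟨ sum-cong-≗ (λ i → trans (sym (∑-distrib-+ (out i) (in′ i))) (sum-cong-≗ (each-edge-once i))) ⟩
      sum (λ i → sum (λ j → ⟦ adj G i j ⟧ * h i))
    ≡⟨ sum-cong-≗ row-sum ⟩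
      sum (λ v → h v * degree G v) ∎
    where
    open ≡-Reasoning
    out in′ : Fin n → Fin n → ℕ
    out i j = ⟦ forward i j ⟧ * h i
    in′ i j = ⟦ forward j i ⟧ * h i
    each-edge-once : ∀ i j → out i j + in′ i j ≡ ⟦ adj G i j ⟧ * h i
    each-edge-once i j = trans (sym (*-distribʳ-+ (h i) ⟦ forward i j ⟧ ⟦ forward j i ⟧))
                               (cong (_* h i) (forward+backward i j))
    row-sum : ∀ i → sum (λ j → ⟦ adj G i j ⟧ * h i) ≡ h i * degree G i
    row-sum i = begin
      sum (λ j → ⟦ adj G i j ⟧ * h i)  ≡⟨ sum-cong-≗ (λ j → *-comm ⟦ adj G i j ⟧ (h i)) ⟩
      sum (λ j → h i * ⟦ adj G i j ⟧)  ≡⟨ *-distribˡ-sum (h i) (⟦_⟧ ∘ adj G i) ⟨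
      h i * sum (⟦_⟧ ∘ adj G i)        ≡⟨ cong (h i *_) (sum-tabulate (⟦_⟧ ∘ adj G i)) ⟨
      h i * degree G i                 ∎

  covers : Subset n → Fin n → Fin n → Bool
  covers S i j = adj G i j ∧ (toℕ i <ᵇ toℕ j) ∧ (lookup S i ∨ lookup S j)

  coveredEdges≡ : ∀ (S : Subset n) → coveredEdges G S ≡ sum (λ i → sum (⟦_⟧ ∘ covers S i))
  coveredEdges≡ S =
    trans (sum-tabulate (λ i → count (covers S i))) (sum-cong-≗ (λ i → sum-tabulate (⟦_⟧ ∘ covers S i)))

  coveredEdges≤sumOver-degree : ∀ (S : Subset n) (R : Fin n → Bool) →
    (∀ i j → adj G i j ≡ true → (lookup S i ∨ lookup S j) ≡ true → (R i ∨ R j) ≡ true) →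
    coveredEdges G S ≤ sumOver R (degree G)
  coveredEdges≤sumOver-degree S R R-hits = begin
      coveredEdges G S
    ≡⟨ coveredEdges≡ S ⟩
      sum (λ i → sum (⟦_⟧ ∘ covers S i))
    ≤⟨ sum-mono (λ i → sum-mono (λ j → ⟦∧∨⟧≤ (adj G i j) (toℕ i <ᵇ toℕ j) _ (R i) (R j) (R-hits i j))) ⟩
      sum (λ i → sum (λ j → ⟦ forward i j ⟧ * (⟦ R i ⟧ + ⟦ R j ⟧)))
    ≡⟨ handshake (⟦_⟧ ∘ R) ⟩
      sum (λ v → ⟦ R v ⟧ * degree G v)
    ≡⟨ sumOver≡sum-* R (degree G) ⟨
      sumOver R (degree G) ∎
    where open ≤-Reasoning

  coveredEdges-independent : ∀ (S : Subset n) → Independent G (lookup S) →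
    coveredEdges G S ≡ sumOver (lookup S) (degree G)
  coveredEdges-independent S indep = begin
      coveredEdges G S
    ≡⟨ coveredEdges≡ S ⟩
      sum (λ i → sum (⟦_⟧ ∘ covers S i))
    ≡⟨ sum-cong-≗ (λ i → sum-cong-≗ (λ j →
         ⟦∧∨⟧-exclusive (adj G i j) (toℕ i <ᵇ toℕ j) (lookup S i) (lookup S j) (indep i j))) ⟨
      sum (λ i → sum (λ j → ⟦ forward i j ⟧ * (⟦ lookup S i ⟧ + ⟦ lookup S j ⟧)))
    ≡⟨ handshake (⟦_⟧ ∘ lookup S) ⟩
      sum (λ v → ⟦ lookup S v ⟧ * degree G v)
    ≡⟨ sumOver≡sum-* (lookup S) (degree G) ⟨
      sumOver (lookup S) (degree G) ∎
    where open ≡-Reasoning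

degree≤ : ∀ {n} (G : Graph n) v → degree G v ≤ n
degree≤ G v = ≤-trans (≤-reflexive (sum-tabulate (⟦_⟧ ∘ adj G v))) (size≤ (adj G v))

IsMin-⇔ : ∀ {P Q : ℕ → Set} → (∀ {k} → P k → ∃ λ k′ → k′ ≤ k × Q k′) → (∀ {k} → Q k → P k) →
          ∀ m → IsMin P m ⇔ IsMin Q m
IsMin-⇔ {P} {Q} P⇒Q≤ Q⇒P m = mk⇔ to from
  where
  to : IsMin P m → IsMin Q m
  to (Pm , m-least) with P⇒Q≤ Pm
  ... | k′ , k′≤m , Qk′ = subst Q (≤-antisym k′≤m (m-least k′ (Q⇒P Qk′))) Qk′ , λ k Qk → m-least k (Q⇒P Qk)
  from : IsMin Q m → IsMin P m
  from (Qm , m-least) = Q⇒P Qm , λ k Pk → let k′ , k′≤k , Qk′ = P⇒Q≤ Pk in ≤-trans (m-least k′ Qk′) k′≤k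

module _ {p n} {x : Fin p → Fin n} (x-injective : Injective _≡_ _≡_ x) where

  size-image-prefix : ∀ {k} → k ≤ p → size (image x (prefix k)) ≡ k
  size-image-prefix {k} k≤p = trans (sumOver-image x x-injective (prefix k) (const 1)) (size-prefix k k≤p)

  prefixDegSum≡sumOver-image : ∀ (G : Graph n) k →
                               prefixDegSum G x k ≡ sumOver (image x (prefix k)) (degree G)
  prefixDegSum≡sumOver-image G k =
    trans (sum-tabulate (λ i → if prefix k i then degree G (x i) else 0))
          (sym (sumOver-image x x-injective (prefix k) (degree G)))

module _ {n p} (G : Graph n) {side : Fin n → Bool} {x : Fin p → Fin n}
         (bip : IsBipartition G side) (enum : Enumerates side x) where

  private
    x-injective : Injective _≡_ _≡_ x
    x-injective = proj₁ enum

    x∈X : ∀ i → side (x i) ≡ true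
    x∈X = proj₁ (proj₂ enum)

    X⊆x : ∀ v → side v ≡ true → ∃ λ i → x i ≡ v
    X⊆x = proj₂ (proj₂ enum)

  image⊆X : ∀ (P : Fin p → Bool) v → image x P v ≡ true → side v ≡ true
  image⊆X P v v∈ with image-sound x P v v∈
  ... | i , _ , refl = x∈X i

  X⊆image-prefix : ∀ v → side v ≡ true → image x (prefix p) v ≡ true
  X⊆image-prefix v v∈X with X⊆x v v∈X
  ... | i , refl = image-complete x (prefix p) i (prefix-complete i (toℕ<n i))

  image-prefix-meets-every-edge : ∀ i j → adj G i j ≡ true →
                                  (image x (prefix p) i ∨ image x (prefix p) j) ≡ true
  image-prefix-meets-every-edge i j eᵢⱼ with side i in sideᵢ | side j in sideⱼ
  ... | true  | _     rewrite X⊆image-prefix i sideᵢ = refl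
  ... | false | true  rewrite X⊆image-prefix j sideⱼ = ∨-zeroʳ _
  ... | false | false = ⊥-elim (bip i j eᵢⱼ (trans sideᵢ (sym sideⱼ)))

  prefixCover : ∀ {k} → k ≤ p → ∃ λ (S : Subset n) → ∣ S ∣ ≡ k × coveredEdges G S ≡ prefixDegSum G x k
  prefixCover {k} k≤p = S , |S|≡k , covered≡
    where
    S : Subset n
    S = tabulate (image x (prefix k))
    S≗image : ∀ v → lookup S v ≡ image x (prefix k) v
    S≗image = lookup∘tabulate (image x (prefix k))
    |S|≡k : ∣ S ∣ ≡ k
    |S|≡k = trans (∣∣≡size S) (trans (sumOver-cong (const 1) S≗image) (size-image-prefix x-injective k≤p))
    S-independent : Independent G (lookup S)
    S-independent = Independent-⊆ G (λ v v∈S → image⊆X (prefix k) v (trans (sym (S≗image v)) v∈S))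
                                  (bipartition-independent G bip)
    covered≡ : coveredEdges G S ≡ prefixDegSum G x k
    covered≡ = begin
        coveredEdges G S                       ≡⟨ coveredEdges-independent G S S-independent ⟩
        sumOver (lookup S) (degree G)          ≡⟨ sumOver-cong (degree G) S≗image ⟩
        sumOver (image x (prefix k)) (degree G) ≡⟨ prefixDegSum≡sumOver-image x-injective G k ⟨
        prefixDegSum G x k                     ∎
      where open ≡-Reasoning

  module _ (dn : DegreeNonincreasing G x) (md : MinDegXGeMaxDegY G side) where

    image-prefix-threshold : ∀ {k} → k ≤ p → ∃ λ c →
      (∀ v → image x (prefix k) v ≡ true → c ≤ degree G v) ×
      (∀ v → image x (prefix k) v ≡ false → degree G v ≤ c)
    image-prefix-threshold {zero} _ = n , nothing-in-prefix₀ , (λ v _ → degree≤ G v)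
      where
      nothing-in-prefix₀ : ∀ v → image x (prefix 0) v ≡ true → n ≤ degree G v
      nothing-in-prefix₀ v v∈ with image-sound x (prefix 0) v v∈
      ... | _ , () , _
    image-prefix-threshold {suc k} k<p = degree G (x last) , inside , outside
      where
      last : Fin p
      last = fromℕ< k<p
      inside : ∀ v → image x (prefix (suc k)) v ≡ true → degree G (x last) ≤ degree G v
      inside v v∈ with image-sound x (prefix (suc k)) v v∈
      ... | i , i<ᵇ1+k , refl =
        dn i last (≤-trans (s≤s⁻¹ (prefix-sound i i<ᵇ1+k)) (≤-reflexive (sym (toℕ-fromℕ< k<p))))
      outside : ∀ v → image x (prefix (suc k)) v ≡ false → degree G v ≤ degree G (x last)
      outside v v∉ with side v in sideᵥ
      ... | false = md (x last) v (x∈X last) sideᵥ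
      ... | true with X⊆x v sideᵥ
      ...   | i , refl with toℕ i <? suc k
      ...     | no  i≮1+k = dn last i (≤-trans (≤-reflexive (toℕ-fromℕ< k<p)) (<⇒≤ (≮⇒≥ i≮1+k)))
      ...     | yes i<1+k with trans (sym v∉) (image-complete x (prefix (suc k)) i (prefix-complete i i<1+k))
      ...       | ()

    coveredEdges≤prefixDegSum : ∀ (S : Subset n) →
      ∃ λ k → k ≤ ∣ S ∣ × k ≤ p × coveredEdges G S ≤ prefixDegSum G x k
    coveredEdges≤prefixDegSum S with ∣ S ∣ ≤? p
    ... | yes |S|≤p with image-prefix-threshold |S|≤p
    ...   | c , above , below = ∣ S ∣ , ≤-refl , |S|≤p , (begin
        coveredEdges G S
      ≤⟨ coveredEdges≤sumOver-degree G S (lookup S) (λ _ _ _ hit → hit) ⟩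
        sumOver (lookup S) (degree G)
      ≤⟨ sumOver-threshold (degree G) (lookup S) (image x (prefix ∣ S ∣)) c above below |S|≤|prefix| ⟩
        sumOver (image x (prefix ∣ S ∣)) (degree G)
      ≡⟨ prefixDegSum≡sumOver-image x-injective G ∣ S ∣ ⟨
        prefixDegSum G x ∣ S ∣ ∎)
      where
      open ≤-Reasoning
      |S|≤|prefix| : size (lookup S) ≤ size (image x (prefix ∣ S ∣))
      |S|≤|prefix| = ≤-reflexive (trans (sym (∣∣≡size S)) (sym (size-image-prefix x-injective |S|≤p)))
    coveredEdges≤prefixDegSum S | no |S|≰p = p , <⇒≤ (≰⇒> |S|≰p) , ≤-refl , (begin
        coveredEdges G S
      ≤⟨ coveredEdges≤sumOver-degree G S (image x (prefix p))
           (λ i j eᵢⱼ _ → image-prefix-meets-every-edge i j eᵢⱼ) ⟩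
        sumOver (image x (prefix p)) (degree G)
      ≡⟨ prefixDegSum≡sumOver-image x-injective G p ⟨
        prefixDegSum G x p ∎)
      where open ≤-Reasoning

mainTheorem5 : ∀ {n p} (G : Graph n) (side : Fin n → Bool) (x : Fin p → Fin n)
    → IsBipartition G side
    → Enumerates side x
    → DegreeNonincreasing G x
    → MinDegXGeMaxDegY G side
    → ∀ (t m : ℕ)
    → IsPβ G t m ⇔ IsMin (λ k → k ≤ p × t ≤ prefixDegSum G x k) m
mainTheorem5 {n} {p} G side x bip enum dn md t = IsMin-⇔ cover⇒prefix prefix⇒cover
  where
  cover⇒prefix : ∀ {k} → (Σ (Subset n) λ S → ∣ S ∣ ≡ k × t ≤ coveredEdges G S) →
                 ∃ λ k′ → k′ ≤ k × (k′ ≤ p × t ≤ prefixDegSum G x k′)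
  cover⇒prefix (S , refl , t≤covered) with coveredEdges≤prefixDegSum G bip enum dn md S
  ... | k′ , k′≤|S| , k′≤p , covered≤ = k′ , k′≤|S| , k′≤p , ≤-trans t≤covered covered≤
  prefix⇒cover : ∀ {k} → k ≤ p × t ≤ prefixDegSum G x k →
                 Σ (Subset n) λ S → ∣ S ∣ ≡ k × t ≤ coveredEdges G S
  prefix⇒cover (k≤p , t≤prefix) with prefixCover G bip enum k≤p
  ... | S , |S|≡k , covered≡ = S , |S|≡k , ≤-trans t≤prefix (≤-reflexive (sym covered≡))
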